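{- Let $\mathbf{G3X}$ be any one of the calculi $\mathbf{G3E}$, $\mathbf{G3EN}$, $\mathbf{G3M}$, $\mathbf{G3MN}$, $\mathbf{G3R}$, $\mathbf{G3K}$, $\mathbf{G3ED^\bot}$, $\mathbf{G3END^\bot}$, $\mathbf{G3ED^\Diamond}$, $\mathbf{G3ED}$, $\mathbf{G3END}$, $\mathbf{G3MD^\bot}$, $\mathbf{G3MND^\bot}$, $\mathbf{G3MD}$, $\mathbf{G3MND}$, $\mathbf{G3RD}$, $\mathbf{G3KD}$ (i.e. those calculi in the family that contain neither $LR$-$C$ nor $L$-$D^{\Diamond_C}$). If $\Gamma\Rightarrow\Delta$ is derivable in $\mathbf{G3X}$, then every partition of $\Gamma\Rightarrow\Delta$ has a $\mathbf{G3X}$-interpolant.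
   Context: Formulas are generated from countably many propositional variables $p_0,p_1,\dots$ and the $0$-ary constant $\bot$ by the binary connectives $\wedge,\vee,\supset$ and the unary operator $\Box$; $\neg A:=A\supset\bot$, $\top:=\bot\supset\bot$, $\Diamond A:=\neg\Box\neg A$. A sequent is an expression $\Gamma\Rightarrow\Delta$ with $\Gamma,\Delta$ finite, possibly empty, multisets of formulas; if $\Pi=A_1,\dots,A_m$ then $\Box\Pi=\Box A_1,\dots,\Box A_m$. A partition of $\Gamma\Rightarrow\Delta$ is a pair of sequents $\langle\Gamma_1\Rightarrow\Delta_1\,\|\,\Gamma_2\Rightarrow\Delta_2\rangle$ with $\Gamma_1,\Gamma_2=\Gamma$ and $\Delta_1,\Delta_2=\Delta$ (multiset unions; any of the four may be empty). A $\mathbf{G3X}$-interpolant of this partition is a formula $I$ such that every propositional variable of $I$ occurs both in some formula of $\Gamma_1\cup\Delta_1$ and in some formula of $\Gamma_2\cup\Delta_2$, and both $\Gamma_1\Rightarrow\Delta_1,I$ and $I,\Gamma_2\Rightarrow\Delta_2$ are derivable in $\mathbf{G3X}$. The calculus $\mathbf{G3cp}$ has initial sequents $p,\Gamma\Rightarrow\Delta,p$ ($p$ a propositional variable), the zero-premiss rule $L\bot$ with conclusion $\bot,\Gamma\Rightarrow\Delta$, and the rules (premisses / conclusion): $L\wedge$: $A,B,\Gamma\Rightarrow\Delta$ / $A\wedge B,\Gamma\Rightarrow\Delta$; $R\wedge$: $\Gamma\Rightarrow\Delta,A$ and $\Gamma\Rightarrow\Delta,B$ / $\Gamma\Rightarrow\Delta,A\wedge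 B$; $L\vee$: $A,\Gamma\Rightarrow\Delta$ and $B,\Gamma\Rightarrow\Delta$ / $A\vee B,\Gamma\Rightarrow\Delta$; $R\vee$: $\Gamma\Rightarrow\Delta,A,B$ / $\Gamma\Rightarrow\Delta,A\vee B$; $L\supset$: $\Gamma\Rightarrow\Delta,A$ and $B,\Gamma\Rightarrow\Delta$ / $A\supset B,\Gamma\Rightarrow\Delta$; $R\supset$: $A,\Gamma\Rightarrow\Delta,B$ / $\Gamma\Rightarrow\Delta,A\supset B$. Modal and deontic rules ($\Gamma,\Delta$ arbitrary): $LR$-$E$: $A\Rightarrow B$ and $B\Rightarrow A$ / $\Box A,\Gamma\Rightarrow\Delta,\Box B$; $LR$-$M$: $A\Rightarrow B$ / $\Box A,\Gamma\Rightarrow\Delta,\Box B$; $LR$-$R$: $A,\Pi\Rightarrow B$ / $\Box A,\Box\Pi,\Gamma\Rightarrow\Delta,\Box B$; $LR$-$K$: $\Pi\Rightarrow B$ / $\Box\Pi,\Gamma\Rightarrow\Delta,\Box B$; $R$-$N$: $\Rightarrow B$ / $\Gamma\Rightarrow\Delta,\Box B$; $L$-$D^\bot$: $A\Rightarrow$ / $\Box A,\Gamma\Rightarrow\Delta$; $L$-$D^{\Diamond_E}$ ($|\Pi|\le2$): $\Pi\Rightarrow$ and $\Rightarrow\Pi$ / $\Box\Pi,\Gamma\Rightarrow\Delta$; $L$-$D^{\Diamond_M}$ ($|\Pi|\le2$): $\Pi\Rightarrow$ / $\Box\Pi,\Gamma\Rightarrow\Delta$; $L$-$D^*$: $\Pi\Rightarrow$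 / $\Box\Pi,\Gamma\Rightarrow\Delta$. Calculi ($\mathbf{G3cp}$ plus): $\mathbf{G3E}$: $LR$-$E$; $\mathbf{G3EN}$: $LR$-$E$, $R$-$N$; $\mathbf{G3M}$: $LR$-$M$; $\mathbf{G3MN}$: $LR$-$M$, $R$-$N$; $\mathbf{G3R}$: $LR$-$R$; $\mathbf{G3K}$: $LR$-$K$; $\mathbf{G3ED^\bot}$ / $\mathbf{G3END^\bot}$: $\mathbf{G3E}$ / $\mathbf{G3EN}$ plus $L$-$D^\bot$; $\mathbf{G3ED^\Diamond}$: $\mathbf{G3E}$ plus $L$-$D^{\Diamond_E}$; $\mathbf{G3ED}$ / $\mathbf{G3END}$: $\mathbf{G3E}$ / $\mathbf{G3EN}$ plus $L$-$D^\bot$ and $L$-$D^{\Diamond_E}$; $\mathbf{G3MD^\bot}$ / $\mathbf{G3MND^\bot}$: $\mathbf{G3M}$ / $\mathbf{G3MN}$ plus $L$-$D^\bot$; $\mathbf{G3MD}$ / $\mathbf{G3MND}$: $\mathbf{G3M}$ / $\mathbf{G3MN}$ plus $L$-$D^{\Diamond_M}$; $\mathbf{G3RD}$, $\mathbf{G3KD}$: $\mathbf{G3R}$, $\mathbf{G3K}$ respectively plus $L$-$D^*$. A derivation is a finite upward-growing tree of sequents whose leaves are initial sequents or conclusions of $L\bot$ and each other node is the conclusion of a rule instance whose premisses are its children. -}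

module Defs where

open import Data.Nat using (ℕ; _≤_)
open import Data.Bool using (Bool; true; false; T)
open import Data.List using (List; []; _∷_; _++_; [_]; map; length)
open import Data.List.Membership.Propositional using (_∈_)
open import Data.List.Relation.Unary.Any using (Any)
open import Data.List.Relation.Binary.Permutation.Propositional using (_↭_)
open import Data.Product using (Σ; _×_)

infixr 6 _∧'_
infixr 5 _∨'_
infixr 4 _⊃'_

data Fm : Set where
  var  : ℕ → Fm
  ⊥'   : Fm
  _∧'_ : Fm → Fm → Fm
  _∨'_ : Fm → Fm → Fm
  _⊃'_ : Fm → Fm → Fm
  □    : Fm → Fm

¬' : Fm → Fm
¬' A = A ⊃' ⊥'

⊤' : Fm
⊤' = ⊥' ⊃' ⊥'

◇ : Fm → Fm
◇ A = ¬' (□ (¬' A))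

vars : Fm → List ℕ
vars (var n)  = n ∷ []
vars ⊥'       = []
vars (A ∧' B) = vars A ++ vars B
vars (A ∨' B) = vars A ++ vars B
vars (A ⊃' B) = vars A ++ vars B
vars (□ A)    = vars A

data Calc : Set where
  G3E G3EN G3M G3MN G3R G3K : Calc
  G3ED⊥ G3END⊥ G3ED◇ G3ED G3END : Calc
  G3MD⊥ G3MND⊥ G3MD G3MND : Calc
  G3RD G3KD : Calc

hasE : Calc → Bool
hasE G3E = true
hasE G3EN = true
hasE G3ED⊥ = true
hasE G3END⊥ = true
hasE G3ED◇ = true
hasE G3ED = true
hasE G3END = true
hasE _ = false

hasM : Calc → Bool
hasM G3M = true
hasM G3MN = true
hasM G3MD⊥ = true
hasM G3MND⊥ = true
hasM G3MD = true
hasM G3MND = true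
hasM _ = false

hasR : Calc → Bool
hasR G3R = true
hasR G3RD = true
hasR _ = false

hasK : Calc → Bool
hasK G3K = true
hasK G3KD = true
hasK _ = false

hasN : Calc → Bool
hasN G3EN = true
hasN G3MN = true
hasN G3END⊥ = true
hasN G3END = true
hasN G3MND⊥ = true
hasN G3MND = true
hasN _ = false

hasD⊥ : Calc → Bool
hasD⊥ G3ED⊥ = true
hasD⊥ G3END⊥ = true
hasD⊥ G3ED = true
hasD⊥ G3END = true
hasD⊥ G3MD⊥ = true
hasD⊥ G3MND⊥ = true
hasD⊥ _ = false

hasD◇E : Calc → Bool
hasD◇E G3ED◇ = true
hasD◇E G3ED = true
hasD◇E G3END = true
hasD◇E _ = false

hasD◇M : Calc → Bool
hasD◇M G3MD = true
hasD◇M G3MND = true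
hasD◇M _ = false

hasD* : Calc → Bool
hasD* G3RD = true
hasD* G3KD = true
hasD* _ = false

□s : List Fm → List Fm
□s = map □

-- Derivability of the sequent Γ ⇒ Δ in calculus X.
-- Sequents are multisets, represented by lists; each rule's conclusion is
-- taken up to permutation (Γ ↭ principal formulas ++ context).
data Der (X : Calc) : List Fm → List Fm → Set where
  ax  : ∀ {Γ Δ Γ' Δ'} p → Γ ↭ var p ∷ Γ' → Δ ↭ var p ∷ Δ' → Der X Γ Δ
  L⊥  : ∀ {Γ Δ Γ'} → Γ ↭ ⊥' ∷ Γ' → Der X Γ Δ
  L∧  : ∀ {Γ Δ Γ' A B} → Γ ↭ (A ∧' B) ∷ Γ' →
        Der X (A ∷ B ∷ Γ') Δ → Der X Γ Δ
  R∧  : ∀ {Γ Δ Δ' A B} → Δ ↭ (A ∧' B) ∷ Δ' →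
        Der X Γ (A ∷ Δ') → Der X Γ (B ∷ Δ') → Der X Γ Δ
  L∨  : ∀ {Γ Δ Γ' A B} → Γ ↭ (A ∨' B) ∷ Γ' →
        Der X (A ∷ Γ') Δ → Der X (B ∷ Γ') Δ → Der X Γ Δ
  R∨  : ∀ {Γ Δ Δ' A B} → Δ ↭ (A ∨' B) ∷ Δ' →
        Der X Γ (A ∷ B ∷ Δ') → Der X Γ Δ
  L⊃  : ∀ {Γ Δ Γ' A B} → Γ ↭ (A ⊃' B) ∷ Γ' →
        Der X Γ' (A ∷ Δ) → Der X (B ∷ Γ') Δ → Der X Γ Δ
  R⊃  : ∀ {Γ Δ Δ' A B} → Δ ↭ (A ⊃' B) ∷ Δ' →
        Der X (A ∷ Γ) (B ∷ Δ') → Der X Γ Δ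
  LR-E : ∀ {Γ Δ Γ' Δ' A B} → T (hasE X) → Γ ↭ □ A ∷ Γ' → Δ ↭ □ B ∷ Δ' →
        Der X [ A ] [ B ] → Der X [ B ] [ A ] → Der X Γ Δ
  LR-M : ∀ {Γ Δ Γ' Δ' A B} → T (hasM X) → Γ ↭ □ A ∷ Γ' → Δ ↭ □ B ∷ Δ' →
        Der X [ A ] [ B ] → Der X Γ Δ
  LR-R : ∀ {Γ Δ Γ' Δ' A B} Π → T (hasR X) → Γ ↭ □ A ∷ □s Π ++ Γ' → Δ ↭ □ B ∷ Δ' →
        Der X (A ∷ Π) [ B ] → Der X Γ Δ
  LR-K : ∀ {Γ Δ Γ' Δ' B} Π → T (hasK X) → Γ ↭ □s Π ++ Γ' → Δ ↭ □ B ∷ Δ' →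
        Der X Π [ B ] → Der X Γ Δ
  R-N  : ∀ {Γ Δ Δ' B} → T (hasN X) → Δ ↭ □ B ∷ Δ' →
        Der X [] [ B ] → Der X Γ Δ
  L-D⊥ : ∀ {Γ Δ Γ' A} → T (hasD⊥ X) → Γ ↭ □ A ∷ Γ' →
        Der X [ A ] [] → Der X Γ Δ
  L-D◇E : ∀ {Γ Δ Γ'} Π → T (hasD◇E X) → length Π ≤ 2 → Γ ↭ □s Π ++ Γ' →
        Der X Π [] → Der X [] Π → Der X Γ Δ
  L-D◇M : ∀ {Γ Δ Γ'} Π → T (hasD◇M X) → length Π ≤ 2 → Γ ↭ □s Π ++ Γ' →
        Der X Π [] → Der X Γ Δ
  L-D* : ∀ {Γ Δ Γ'} Π → T (hasD* X) → Γ ↭ □s Π ++ Γ' →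
        Der X Π [] → Der X Γ Δ

OccursIn : ℕ → List Fm → Set
OccursIn p Φ = Any (λ A → p ∈ vars A) Φ

Interpolant : Calc → List Fm → List Fm → List Fm → List Fm → Fm → Set
Interpolant X Γ₁ Δ₁ Γ₂ Δ₂ I =
  (∀ p → p ∈ vars I → OccursIn p (Γ₁ ++ Δ₁) × OccursIn p (Γ₂ ++ Δ₂)) ×
  Der X Γ₁ (Δ₁ ++ [ I ]) × Der X (I ∷ Γ₂) Δ₂

module Submission where

-- Cut is needed only
-- there: for LR-E and L-D◇E the new interpolant □C must be equivalent to a
-- premiss formula in both directions, and one direction arises by cut.
-- Then interpolants are introduced with the variable condition Φ ⊑ Ψ; the
-- negation of an interpolant of the swapped partition interpolates, so each
-- rule is treated with its principal formula in the first part only.  The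
-- rule cases follow: propositional rules keep the interpolant or take the
-- disjunction of two; a modal or deontic rule whose boxed principal formulas
-- are split by the partition gets □C for an interpolant C of the split
-- premiss, and otherwise one part is derivable alone and ⊥ or ⊤ suffices.

open import Defs
open import Data.Nat using (_≤_; s≤s; z≤n)
open import Data.List using (List; []; _∷_; _++_; [_]; length)
open import Data.List.Relation.Binary.Permutation.Propositional
  using (_↭_; ↭-refl; ↭-sym; ↭-trans; prep; swap)
open import Data.List.Relation.Binary.Permutation.Propositional.Properties
  using (shift; shifts; drop-∷; ∈-resp-↭; Any-resp-↭; ++⁺ˡ; ++⁺ʳ; ++-comm; ++-assoc; ++-identityʳ; ↭-length; ↭-empty-inv; ↭-singleton-inv)
open import Data.List.Membership.Propositional using (_∈_)
open import Data.List.Membership.Propositional.Properties using (∈-∃++)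
open import Data.List.Relation.Unary.Any using (here; there)
import Data.List.Relation.Unary.Any.Properties as Any
open import Data.Product using (Σ; ∃; _×_; _,_; proj₂)
open import Data.Sum using (_⊎_; inj₁; inj₂)
open import Data.Bool using (T)
open import Data.Empty using (⊥-elim)
open import Relation.Nullary using (¬_)
open import Relation.Binary.PropositionalEquality using (_≡_; _≢_; sym; subst) renaming (refl to ≡-refl)

private variable
  X : Calc
  Γ Δ Γ' Δ' Γf Δf G G' : List Fm
  A B C x y : Fm

∈⇒↭ : x ∈ G → ∃ λ G' → G ↭ x ∷ G'
∈⇒↭ m with ys , zs , ≡-refl ← ∈-∃++ m = ys ++ zs , shift _ ys zs

-- This is
-- the case split "is the principal formula the distinguished one or not".
compare-heads : x ∷ Γ ↭ y ∷ Γ' →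
  (x ≡ y × Γ ↭ Γ') ⊎ ∃ λ Γ₀ → Γ ↭ y ∷ Γ₀ × Γ' ↭ x ∷ Γ₀
compare-heads {x} {Γ} {y} p with ∈-resp-↭ (↭-sym p) (here ≡-refl)
... | here ≡-refl = inj₁ (≡-refl , drop-∷ p)
... | there m with ∈⇒↭ m
... | Γ₀ , e = inj₂ (Γ₀ , e , ↭-sym (drop-∷ (↭-trans (swap y x ↭-refl) (↭-trans (prep x (↭-sym e)) p))))

keep-head : ∀ z → Γ ↭ y ∷ Γ' → z ∷ Γ ↭ y ∷ z ∷ Γ'
keep-head z e = ↭-trans (prep z e) (swap z _ ↭-refl)

keep-heads : ∀ z M → Γ ↭ M ++ Γ' → z ∷ Γ ↭ M ++ z ∷ Γ'
keep-heads {Γ' = Γ'} z M e = ↭-trans (prep z e) (↭-sym (shift z M Γ'))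

prefix-head : ∀ L → Γ ↭ y ∷ Γ' → L ++ Γ ↭ y ∷ L ++ Γ'
prefix-head {y = y} {Γ'} L e = ↭-trans (++⁺ˡ L e) (shift y L Γ')

prefix-heads : ∀ L M → Γ ↭ M ++ Γ' → L ++ Γ ↭ M ++ L ++ Γ'
prefix-heads L M e = ↭-trans (++⁺ˡ L e) (shifts L M)

shift₂ : ∀ L → L ++ x ∷ y ∷ Γ ↭ x ∷ y ∷ L ++ Γ
shift₂ {x} {y} {Γ} L = ↭-trans (shift x L (y ∷ Γ)) (prep x (shift y L Γ))

swap₁ : x ∷ y ∷ Γ ↭ y ∷ x ∷ Γ
swap₁ {x} {y} = swap x y ↭-refl

rotate₃ : x ∷ y ∷ A ∷ Γ ↭ y ∷ A ∷ x ∷ Γ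
rotate₃ {x} {y} {A} = ↭-trans (swap x y ↭-refl) (prep y (swap x A ↭-refl))

reverse₃ : x ∷ y ∷ A ∷ Γ ↭ A ∷ y ∷ x ∷ Γ
reverse₃ {x} {y} {A} = ↭-trans (swap x y ↭-refl) (↭-trans (prep y (swap x A ↭-refl)) (swap y A ↭-refl))

skip-boxes : (∀ {A} → x ≢ □ A) → ∀ Π → □s Π ++ G ↭ x ∷ Γ →
  ∃ λ G₀ → G ↭ x ∷ G₀ × Γ ↭ □s Π ++ G₀
skip-boxes nb [] e = _ , e , ↭-refl
skip-boxes nb (A ∷ Π) e with compare-heads e
... | inj₁ (x≡□A , _) = ⊥-elim (nb (sym x≡□A))
... | inj₂ (Γ₀ , e₁ , e₂) with skip-boxes nb Π e₁
... | G₀ , f₁ , f₂ = G₀ , f₁ , ↭-trans e₂ (prep (□ A) f₂)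

∈-remove-other : x ∈ G → G ↭ y ∷ Γ → x ≢ y → x ∈ Γ
∈-remove-other m e x≢y with ∈-resp-↭ e m
... | here x≡y = ⊥-elim (x≢y x≡y)
... | there m' = m'

relate : G ↭ Γ → G ↭ Δ → Γ ↭ Δ
relate e g = ↭-trans (↭-sym e) g

perm : Γ ↭ Γ' → Δ ↭ Δ' → Der X Γ Δ → Der X Γ' Δ'
perm g h (ax p e f) = ax p (relate g e) (relate h f)
perm g h (L⊥ e) = L⊥ (relate g e)
perm g h (L∧ e d) = L∧ (relate g e) (perm ↭-refl h d)
perm g h (R∧ e d₁ d₂) = R∧ (relate h e) (perm g ↭-refl d₁) (perm g ↭-refl d₂)
perm g h (L∨ e d₁ d₂) = L∨ (relate g e) (perm ↭-refl h d₁) (perm ↭-refl h d₂)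
perm g h (R∨ e d) = R∨ (relate h e) (perm g ↭-refl d)
perm g h (L⊃ e d₁ d₂) = L⊃ (relate g e) (perm ↭-refl (prep _ h) d₁) (perm ↭-refl h d₂)
perm g h (R⊃ e d) = R⊃ (relate h e) (perm (prep _ g) ↭-refl d)
perm g h (LR-E t e f d₁ d₂) = LR-E t (relate g e) (relate h f) d₁ d₂
perm g h (LR-M t e f d) = LR-M t (relate g e) (relate h f) d
perm g h (LR-R Π t e f d) = LR-R Π t (relate g e) (relate h f) d
perm g h (LR-K Π t e f d) = LR-K Π t (relate g e) (relate h f) d
perm g h (R-N t f d) = R-N t (relate h f) d
perm g h (L-D⊥ t e d) = L-D⊥ t (relate g e) d
perm g h (L-D◇E Π t l e d₁ d₂) = L-D◇E Π t l (relate g e) d₁ d₂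
perm g h (L-D◇M Π t l e d) = L-D◇M Π t l (relate g e) d
perm g h (L-D* Π t e d) = L-D* Π t (relate g e) d

permL : Γ ↭ Γ' → Der X Γ Δ → Der X Γ' Δ
permL g = perm g ↭-refl

permR : Δ ↭ Δ' → Der X Γ Δ → Der X Γ Δ'
permR h = perm ↭-refl h

-- Weakening is admissible on both sides (the context is simply carried
-- along; modal rules absorb it in their arbitrary Γ, Δ).
weakenL : ∀ z → Der X Γ Δ → Der X (z ∷ Γ) Δ
weakenL z (ax p e f) = ax p (keep-head z e) f
weakenL z (L⊥ e) = L⊥ (keep-head z e)
weakenL z (L∧ e d) = L∧ (keep-head z e) (permL rotate₃ (weakenL z d))
weakenL z (R∧ e d₁ d₂) = R∧ e (weakenL z d₁) (weakenL z d₂)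
weakenL z (L∨ e d₁ d₂) = L∨ (keep-head z e) (permL swap₁ (weakenL z d₁)) (permL swap₁ (weakenL z d₂))
weakenL z (R∨ e d) = R∨ e (weakenL z d)
weakenL z (L⊃ e d₁ d₂) = L⊃ (keep-head z e) (weakenL z d₁) (permL swap₁ (weakenL z d₂))
weakenL z (R⊃ e d) = R⊃ e (permL swap₁ (weakenL z d))
weakenL z (LR-E t e f d₁ d₂) = LR-E t (keep-head z e) f d₁ d₂
weakenL z (LR-M t e f d) = LR-M t (keep-head z e) f d
weakenL z (LR-R {A = A} Π t e f d) = LR-R Π t (keep-heads z (□s (A ∷ Π)) e) f d
weakenL z (LR-K Π t e f d) = LR-K Π t (keep-heads z (□s Π) e) f d
weakenL z (R-N t f d) = R-N t f d
weakenL z (L-D⊥ t e d) = L-D⊥ t (keep-head z e) d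
weakenL z (L-D◇E Π t l e d₁ d₂) = L-D◇E Π t l (keep-heads z (□s Π) e) d₁ d₂
weakenL z (L-D◇M Π t l e d) = L-D◇M Π t l (keep-heads z (□s Π) e) d
weakenL z (L-D* Π t e d) = L-D* Π t (keep-heads z (□s Π) e) d

weakenR : ∀ z → Der X Γ Δ → Der X Γ (z ∷ Δ)
weakenR z (ax p e f) = ax p e (keep-head z f)
weakenR z (L⊥ e) = L⊥ e
weakenR z (L∧ e d) = L∧ e (weakenR z d)
weakenR z (R∧ e d₁ d₂) = R∧ (keep-head z e) (permR swap₁ (weakenR z d₁)) (permR swap₁ (weakenR z d₂))
weakenR z (L∨ e d₁ d₂) = L∨ e (weakenR z d₁) (weakenR z d₂)
weakenR z (R∨ e d) = R∨ (keep-head z e) (permR rotate₃ (weakenR z d))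
weakenR z (L⊃ e d₁ d₂) = L⊃ e (permR swap₁ (weakenR z d₁)) (weakenR z d₂)
weakenR z (R⊃ e d) = R⊃ (keep-head z e) (permR swap₁ (weakenR z d))
weakenR z (LR-E t e f d₁ d₂) = LR-E t e (keep-head z f) d₁ d₂
weakenR z (LR-M t e f d) = LR-M t e (keep-head z f) d
weakenR z (LR-R Π t e f d) = LR-R Π t e (keep-head z f) d
weakenR z (LR-K Π t e f d) = LR-K Π t e (keep-head z f) d
weakenR z (R-N t f d) = R-N t (keep-head z f) d
weakenR z (L-D⊥ t e d) = L-D⊥ t e d
weakenR z (L-D◇E Π t l e d₁ d₂) = L-D◇E Π t l e d₁ d₂
weakenR z (L-D◇M Π t l e d) = L-D◇M Π t l e d
weakenR z (L-D* Π t e d) = L-D* Π t e d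

weaken-empty : Der X [] [] → Der X Γ Δ
weaken-empty {Γ = z ∷ Γ} d = weakenL z (weaken-empty d)
weaken-empty {Γ = []} {Δ = z ∷ Δ} d = weakenR z (weaken-empty d)
weaken-empty {Γ = []} {Δ = []} d = d

-- Compound formulas are the principal formulas of the propositional rules;
-- prime formulas (variables, ⊥ and boxed formulas) never are.
data Compound : Fm → Set where
  ∧-compound : Compound (A ∧' B)
  ∨-compound : Compound (A ∨' B)
  ⊃-compound : Compound (A ⊃' B)

data Prime : Fm → Set where
  var-prime : ∀ {p} → Prime (var p)
  ⊥-prime   : Prime ⊥'
  □-prime   : Prime (□ A)

prime≢compound : Prime x → Compound y → x ≢ y
prime≢compound var-prime ∧-compound ()
prime≢compound var-prime ∨-compound ()
prime≢compound var-prime ⊃-compound ()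
prime≢compound ⊥-prime ∧-compound ()
prime≢compound ⊥-prime ∨-compound ()
prime≢compound ⊥-prime ⊃-compound ()
prime≢compound □-prime ∧-compound ()
prime≢compound □-prime ∨-compound ()
prime≢compound □-prime ⊃-compound ()

compound≢□ : Compound x → x ≢ □ A
compound≢□ cx x≡□A = prime≢compound □-prime cx (sym x≡□A)

-- Suppose every
-- rule instance with principal formula x, applied to premisses over Γ ⇒ Δ,
-- can be replaced by a derivation of L, Γ ⇒ R, Δ.  Then every derivation of
-- x, Γ ⇒ Δ yields one of L, Γ ⇒ R, Δ: an occurrence of x that is not
-- principal is carried through the rule, and modal rules never use it.
module InvertLeft {X : Calc} (x : Fm) (cx : Compound x) (L R : List Fm)
  (on∧ : ∀ {Γ Δ A B} → x ≡ A ∧' B → Der X (A ∷ B ∷ Γ) Δ → Der X (L ++ Γ) (R ++ Δ))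
  (on∨ : ∀ {Γ Δ A B} → x ≡ A ∨' B → Der X (A ∷ Γ) Δ → Der X (B ∷ Γ) Δ → Der X (L ++ Γ) (R ++ Δ))
  (on⊃ : ∀ {Γ Δ A B} → x ≡ (A ⊃' B) → Der X Γ (A ∷ Δ) → Der X (B ∷ Γ) Δ → Der X (L ++ Γ) (R ++ Δ))
  where
  invertL : Der X Γf Δ → Γf ↭ x ∷ Γ → Der X (L ++ Γ) (R ++ Δ)
  invertL (ax p e f) g with compare-heads (relate e g)
  ... | inj₁ (q , _) = ⊥-elim (prime≢compound var-prime cx q)
  ... | inj₂ (_ , _ , e₂) = ax p (prefix-head L e₂) (prefix-head R f)
  invertL (L⊥ e) g with compare-heads (relate e g)
  ... | inj₁ (q , _) = ⊥-elim (prime≢compound ⊥-prime cx q)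
  ... | inj₂ (_ , _ , e₂) = L⊥ (prefix-head L e₂)
  invertL (L∧ {A = A} {B} e d) g with compare-heads (relate e g)
  ... | inj₁ (q , e') = on∧ (sym q) (permL (prep A (prep B e')) d)
  ... | inj₂ (_ , e₁ , e₂) =
    L∧ (prefix-head L e₂) (permL (shift₂ L) (invertL d (↭-trans (prep A (prep B e₁)) (↭-sym rotate₃))))
  invertL (R∧ e d₁ d₂) g =
    R∧ (prefix-head R e) (permR (shift _ R _) (invertL d₁ g)) (permR (shift _ R _) (invertL d₂ g))
  invertL (L∨ {A = A} {B} e d₁ d₂) g with compare-heads (relate e g)
  ... | inj₁ (q , e') = on∨ (sym q) (permL (prep A e') d₁) (permL (prep B e') d₂)
  ... | inj₂ (_ , e₁ , e₂) =
    L∨ (prefix-head L e₂) (permL (shift _ L _) (invertL d₁ (keep-head A e₁)))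
                          (permL (shift _ L _) (invertL d₂ (keep-head B e₁)))
  invertL (R∨ e d) g = R∨ (prefix-head R e) (permR (shift₂ R) (invertL d g))
  invertL (L⊃ {A = A} {B} e d₁ d₂) g with compare-heads (relate e g)
  ... | inj₁ (q , e') = on⊃ (sym q) (permL e' d₁) (permL (prep B e') d₂)
  ... | inj₂ (_ , e₁ , e₂) =
    L⊃ (prefix-head L e₂) (permR (shift _ R _) (invertL d₁ e₁))
                          (permL (shift _ L _) (invertL d₂ (keep-head B e₁)))
  invertL (R⊃ {A = A} e d) g =
    R⊃ (prefix-head R e) (perm (shift _ L _) (shift _ R _) (invertL d (keep-head A g)))
  invertL (LR-E t e f d₁ d₂) g with compare-heads (relate e g)
  ... | inj₁ (q , _) = ⊥-elim (prime≢compound □-prime cx q)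
  ... | inj₂ (_ , _ , e₂) = LR-E t (prefix-head L e₂) (prefix-head R f) d₁ d₂
  invertL (LR-M t e f d) g with compare-heads (relate e g)
  ... | inj₁ (q , _) = ⊥-elim (prime≢compound □-prime cx q)
  ... | inj₂ (_ , _ , e₂) = LR-M t (prefix-head L e₂) (prefix-head R f) d
  invertL (LR-R {A = A} Π t e f d) g with skip-boxes (compound≢□ cx) (A ∷ Π) (relate e g)
  ... | _ , _ , e₂ = LR-R Π t (prefix-heads L (□s (A ∷ Π)) e₂) (prefix-head R f) d
  invertL (LR-K Π t e f d) g with skip-boxes (compound≢□ cx) Π (relate e g)
  ... | _ , _ , e₂ = LR-K Π t (prefix-heads L (□s Π) e₂) (prefix-head R f) d
  invertL (R-N t f d) g = R-N t (prefix-head R f) d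
  invertL (L-D⊥ t e d) g with compare-heads (relate e g)
  ... | inj₁ (q , _) = ⊥-elim (prime≢compound □-prime cx q)
  ... | inj₂ (_ , _ , e₂) = L-D⊥ t (prefix-head L e₂) d
  invertL (L-D◇E Π t l e d₁ d₂) g with skip-boxes (compound≢□ cx) Π (relate e g)
  ... | _ , _ , e₂ = L-D◇E Π t l (prefix-heads L (□s Π) e₂) d₁ d₂
  invertL (L-D◇M Π t l e d) g with skip-boxes (compound≢□ cx) Π (relate e g)
  ... | _ , _ , e₂ = L-D◇M Π t l (prefix-heads L (□s Π) e₂) d
  invertL (L-D* Π t e d) g with skip-boxes (compound≢□ cx) Π (relate e g)
  ... | _ , _ , e₂ = L-D* Π t (prefix-heads L (□s Π) e₂) d

module InvertRight {X : Calc} (x : Fm) (cx : Compound x) (L R : List Fm)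
  (on∧ : ∀ {Γ Δ A B} → x ≡ A ∧' B → Der X Γ (A ∷ Δ) → Der X Γ (B ∷ Δ) → Der X (L ++ Γ) (R ++ Δ))
  (on∨ : ∀ {Γ Δ A B} → x ≡ A ∨' B → Der X Γ (A ∷ B ∷ Δ) → Der X (L ++ Γ) (R ++ Δ))
  (on⊃ : ∀ {Γ Δ A B} → x ≡ (A ⊃' B) → Der X (A ∷ Γ) (B ∷ Δ) → Der X (L ++ Γ) (R ++ Δ))
  where
  invertR : Der X Γ Δf → Δf ↭ x ∷ Δ → Der X (L ++ Γ) (R ++ Δ)
  invertR (ax p e f) g with compare-heads (relate f g)
  ... | inj₁ (q , _) = ⊥-elim (prime≢compound var-prime cx q)
  ... | inj₂ (_ , _ , e₂) = ax p (prefix-head L e) (prefix-head R e₂)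
  invertR (L⊥ e) g = L⊥ (prefix-head L e)
  invertR (L∧ e d) g = L∧ (prefix-head L e) (permL (shift₂ L) (invertR d g))
  invertR (R∧ {A = A} {B} e d₁ d₂) g with compare-heads (relate e g)
  ... | inj₁ (q , e') = on∧ (sym q) (permR (prep A e') d₁) (permR (prep B e') d₂)
  ... | inj₂ (_ , e₁ , e₂) =
    R∧ (prefix-head R e₂) (permR (shift _ R _) (invertR d₁ (keep-head A e₁)))
                          (permR (shift _ R _) (invertR d₂ (keep-head B e₁)))
  invertR (L∨ e d₁ d₂) g =
    L∨ (prefix-head L e) (permL (shift _ L _) (invertR d₁ g)) (permL (shift _ L _) (invertR d₂ g))
  invertR (R∨ {A = A} {B} e d) g with compare-heads (relate e g)
  ... | inj₁ (q , e') = on∨ (sym q) (permR (prep A (prep B e')) d)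
  ... | inj₂ (_ , e₁ , e₂) =
    R∨ (prefix-head R e₂) (permR (shift₂ R) (invertR d (↭-trans (prep A (prep B e₁)) (↭-sym rotate₃))))
  invertR (L⊃ {A = A} e d₁ d₂) g =
    L⊃ (prefix-head L e) (permR (shift _ R _) (invertR d₁ (keep-head A g)))
                         (permL (shift _ L _) (invertR d₂ g))
  invertR (R⊃ {A = A} {B} e d) g with compare-heads (relate e g)
  ... | inj₁ (q , e') = on⊃ (sym q) (permR (prep B e') d)
  ... | inj₂ (_ , e₁ , e₂) =
    R⊃ (prefix-head R e₂) (perm (shift _ L _) (shift _ R _) (invertR d (keep-head B e₁)))
  invertR (LR-E t e f d₁ d₂) g with compare-heads (relate f g)
  ... | inj₁ (q , _) = ⊥-elim (prime≢compound □-prime cx q)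
  ... | inj₂ (_ , _ , e₂) = LR-E t (prefix-head L e) (prefix-head R e₂) d₁ d₂
  invertR (LR-M t e f d) g with compare-heads (relate f g)
  ... | inj₁ (q , _) = ⊥-elim (prime≢compound □-prime cx q)
  ... | inj₂ (_ , _ , e₂) = LR-M t (prefix-head L e) (prefix-head R e₂) d
  invertR (LR-R {A = A} Π t e f d) g with compare-heads (relate f g)
  ... | inj₁ (q , _) = ⊥-elim (prime≢compound □-prime cx q)
  ... | inj₂ (_ , _ , e₂) = LR-R Π t (prefix-heads L (□s (A ∷ Π)) e) (prefix-head R e₂) d
  invertR (LR-K Π t e f d) g with compare-heads (relate f g)
  ... | inj₁ (q , _) = ⊥-elim (prime≢compound □-prime cx q)
  ... | inj₂ (_ , _ , e₂) = LR-K Π t (prefix-heads L (□s Π) e) (prefix-head R e₂) d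
  invertR (R-N t f d) g with compare-heads (relate f g)
  ... | inj₁ (q , _) = ⊥-elim (prime≢compound □-prime cx q)
  ... | inj₂ (_ , _ , e₂) = R-N t (prefix-head R e₂) d
  invertR (L-D⊥ t e d) g = L-D⊥ t (prefix-head L e) d
  invertR (L-D◇E Π t l e d₁ d₂) g = L-D◇E Π t l (prefix-heads L (□s Π) e) d₁ d₂
  invertR (L-D◇M Π t l e d) g = L-D◇M Π t l (prefix-heads L (□s Π) e) d
  invertR (L-D* Π t e d) g = L-D* Π t (prefix-heads L (□s Π) e) d

open InvertLeft using (invertL)
open InvertRight using (invertR)

invL∧ : Der X Γf Δ → Γf ↭ (A ∧' B) ∷ Γ → Der X (A ∷ B ∷ Γ) Δ
invL∧ {A = A} {B} = invertL (A ∧' B) ∧-compound (A ∷ B ∷ []) [] (λ { ≡-refl d → d }) (λ ()) (λ ())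

invL∨₁ : Der X Γf Δ → Γf ↭ (A ∨' B) ∷ Γ → Der X (A ∷ Γ) Δ
invL∨₁ {A = A} {B} = invertL (A ∨' B) ∨-compound [ A ] [] (λ ()) (λ { ≡-refl d₁ _ → d₁ }) (λ ())

invL∨₂ : Der X Γf Δ → Γf ↭ (A ∨' B) ∷ Γ → Der X (B ∷ Γ) Δ
invL∨₂ {A = A} {B} = invertL (A ∨' B) ∨-compound [ B ] [] (λ ()) (λ { ≡-refl _ d₂ → d₂ }) (λ ())

invL⊃₁ : Der X Γf Δ → Γf ↭ (A ⊃' B) ∷ Γ → Der X Γ (A ∷ Δ)
invL⊃₁ {A = A} {B} = invertL (A ⊃' B) ⊃-compound [] [ A ] (λ ()) (λ ()) (λ { ≡-refl d₁ _ → d₁ })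

invL⊃₂ : Der X Γf Δ → Γf ↭ (A ⊃' B) ∷ Γ → Der X (B ∷ Γ) Δ
invL⊃₂ {A = A} {B} = invertL (A ⊃' B) ⊃-compound [ B ] [] (λ ()) (λ ()) (λ { ≡-refl _ d₂ → d₂ })

invR∧₁ : Der X Γ Δf → Δf ↭ (A ∧' B) ∷ Δ → Der X Γ (A ∷ Δ)
invR∧₁ {A = A} {B} = invertR (A ∧' B) ∧-compound [] [ A ] (λ { ≡-refl d₁ _ → d₁ }) (λ ()) (λ ())

invR∧₂ : Der X Γ Δf → Δf ↭ (A ∧' B) ∷ Δ → Der X Γ (B ∷ Δ)
invR∧₂ {A = A} {B} = invertR (A ∧' B) ∧-compound [] [ B ] (λ { ≡-refl _ d₂ → d₂ }) (λ ()) (λ ())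

invR∨ : Der X Γ Δf → Δf ↭ (A ∨' B) ∷ Δ → Der X Γ (A ∷ B ∷ Δ)
invR∨ {A = A} {B} = invertR (A ∨' B) ∨-compound [] (A ∷ B ∷ []) (λ ()) (λ { ≡-refl d → d }) (λ ())

invR⊃ : Der X Γ Δf → Δf ↭ (A ⊃' B) ∷ Δ → Der X (A ∷ Γ) (B ∷ Δ)
invR⊃ {A = A} {B} = invertR (A ⊃' B) ⊃-compound [ A ] [ B ] (λ ()) (λ ()) (λ { ≡-refl d → d })

-- This is the initial-sequent case of cut
-- elimination below.
contract-var : ∀ {q} → Der X Γf Δ → Γf ↭ var q ∷ Γ → var q ∈ Γ → Der X Γ Δ
contract-var (ax p e f) g m with ∈-resp-↭ g (∈-resp-↭ (↭-sym e) (here ≡-refl))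
... | here ≡-refl = ax p (proj₂ (∈⇒↭ m)) f
... | there m' = ax p (proj₂ (∈⇒↭ m')) f
contract-var (L⊥ e) g m with ∈-resp-↭ g (∈-resp-↭ (↭-sym e) (here ≡-refl))
... | here ()
... | there m' = L⊥ (proj₂ (∈⇒↭ m'))
contract-var (L∧ {A = A} {B} e d) g m with compare-heads (relate e g)
... | inj₁ (() , _)
... | inj₂ (_ , e₁ , e₂) =
  L∧ e₂ (contract-var d (↭-trans (prep A (prep B e₁)) (↭-sym rotate₃)) (there (there (∈-remove-other m e₂ λ ()))))
contract-var (R∧ e d₁ d₂) g m = R∧ e (contract-var d₁ g m) (contract-var d₂ g m)
contract-var (L∨ {A = A} {B} e d₁ d₂) g m with compare-heads (relate e g)
... | inj₁ (() , _)
... | inj₂ (_ , e₁ , e₂) =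
  L∨ e₂ (contract-var d₁ (keep-head A e₁) (there (∈-remove-other m e₂ λ ())))
        (contract-var d₂ (keep-head B e₁) (there (∈-remove-other m e₂ λ ())))
contract-var (R∨ e d) g m = R∨ e (contract-var d g m)
contract-var (L⊃ {B = B} e d₁ d₂) g m with compare-heads (relate e g)
... | inj₁ (() , _)
... | inj₂ (_ , e₁ , e₂) =
  L⊃ e₂ (contract-var d₁ e₁ (∈-remove-other m e₂ λ ()))
        (contract-var d₂ (keep-head B e₁) (there (∈-remove-other m e₂ λ ())))
contract-var (R⊃ {A = A} e d) g m = R⊃ e (contract-var d (keep-head A g) (there m))
contract-var (LR-E t e f d₁ d₂) g m with compare-heads (relate e g)
... | inj₁ (() , _)
... | inj₂ (_ , _ , e₂) = LR-E t e₂ f d₁ d₂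
contract-var (LR-M t e f d) g m with compare-heads (relate e g)
... | inj₁ (() , _)
... | inj₂ (_ , _ , e₂) = LR-M t e₂ f d
contract-var (LR-R {A = A} Π t e f d) g m with skip-boxes (λ ()) (A ∷ Π) (relate e g)
... | _ , _ , e₂ = LR-R Π t e₂ f d
contract-var (LR-K Π t e f d) g m with skip-boxes (λ ()) Π (relate e g)
... | _ , _ , e₂ = LR-K Π t e₂ f d
contract-var (R-N t f d) g m = R-N t f d
contract-var (L-D⊥ t e d) g m with compare-heads (relate e g)
... | inj₁ (() , _)
... | inj₂ (_ , _ , e₂) = L-D⊥ t e₂ d
contract-var (L-D◇E Π t l e d₁ d₂) g m with skip-boxes (λ ()) Π (relate e g)
... | _ , _ , e₂ = L-D◇E Π t l e₂ d₁ d₂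
contract-var (L-D◇M Π t l e d) g m with skip-boxes (λ ()) Π (relate e g)
... | _ , _ , e₂ = L-D◇M Π t l e₂ d
contract-var (L-D* Π t e d) g m with skip-boxes (λ ()) Π (relate e g)
... | _ , _ , e₂ = L-D* Π t e₂ d

record E-family (X : Calc) : Set where
  field
    no-M   : ¬ T (hasM X)
    no-R   : ¬ T (hasR X)
    no-K   : ¬ T (hasK X)
    no-D◇M : ¬ T (hasD◇M X)
    no-D*  : ¬ T (hasD* X)

E-family-of : T (hasE X) → E-family X
E-family-of {G3E}    _ = record { no-M = λ () ; no-R = λ () ; no-K = λ () ; no-D◇M = λ () ; no-D* = λ () }
E-family-of {G3EN}   _ = record { no-M = λ () ; no-R = λ () ; no-K = λ () ; no-D◇M = λ () ; no-D* = λ () }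
E-family-of {G3ED⊥}  _ = record { no-M = λ () ; no-R = λ () ; no-K = λ () ; no-D◇M = λ () ; no-D* = λ () }
E-family-of {G3END⊥} _ = record { no-M = λ () ; no-R = λ () ; no-K = λ () ; no-D◇M = λ () ; no-D* = λ () }
E-family-of {G3ED◇}  _ = record { no-M = λ () ; no-R = λ () ; no-K = λ () ; no-D◇M = λ () ; no-D* = λ () }
E-family-of {G3ED}   _ = record { no-M = λ () ; no-R = λ () ; no-K = λ () ; no-D◇M = λ () ; no-D* = λ () }
E-family-of {G3END}  _ = record { no-M = λ () ; no-R = λ () ; no-K = λ () ; no-D◇M = λ () ; no-D* = λ () }

N-D◇E⇒D⊥ : T (hasN X) → T (hasD◇E X) → T (hasD⊥ X)
N-D◇E⇒D⊥ {G3END} _ _ = _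

-- A boxed formula □B in the antecedent that was introduced in the
-- succedent by LR-E or R-N over the antecedent Γ: either Γ contains some
-- □C with C ⇔ B, or B is provable and R-N is available.
data BoxEvidence (X : Calc) (B : Fm) (Γ : List Fm) : Set where
  via-E : ∀ {C} → □ C ∈ Γ → Der X [ C ] [ B ] → Der X [ B ] [ C ] → BoxEvidence X B Γ
  via-N : T (hasN X) → Der X [] [ B ] → BoxEvidence X B Γ

evidence-remove : BoxEvidence X B Γ → Γ ↭ y ∷ Γ' → Compound y → BoxEvidence X B Γ'
evidence-remove (via-E m d₁ d₂) e cy = via-E (∈-remove-other m e λ q → compound≢□ cy (sym q)) d₁ d₂
evidence-remove (via-N t d) e cy = via-N t d

evidence-extend : BoxEvidence X B Γ → BoxEvidence X B (y ∷ Γ)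
evidence-extend (via-E m d₁ d₂) = via-E (there m) d₁ d₂
evidence-extend (via-N t d) = via-N t d

-- The proof is by induction on the
-- cut formula and, inside, on the derivations:
--  * cut          a compound cut formula is split by invertibility;
--  * cut-prime    a prime cut formula is traced up the left derivation
--                 until it is principal there (initial sequent, LR-E, R-N);
--  * cut-boxed    a cut formula □B introduced by LR-E or R-N (recorded as
--                 BoxEvidence) is traced up the derivation using it in the
--                 antecedent; each rule with principal □B is rewired to the
--                 equivalent □C (or to R-N, L-D⊥ when B is provable), at the
--                 price of cuts on the smaller formula B.
mutual
  cut : T (hasE X) → ∀ A → Der X Γ (A ∷ Δ) → Der X (A ∷ Γ) Δ → Der X Γ Δ
  cut t (var p) d₁ d₂ = cut-prime t (var p) var-prime d₁ ↭-refl d₂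
  cut t ⊥' d₁ d₂ = cut-prime t ⊥' ⊥-prime d₁ ↭-refl d₂
  cut t (□ B) d₁ d₂ = cut-prime t (□ B) □-prime d₁ ↭-refl d₂
  cut t (A ∧' B) d₁ d₂ =
    cut t A (invR∧₁ d₁ ↭-refl) (cut t B (weakenL A (invR∧₂ d₁ ↭-refl)) (permL swap₁ (invL∧ d₂ ↭-refl)))
  cut t (A ∨' B) d₁ d₂ =
    cut t B (cut t A (invR∨ d₁ ↭-refl) (weakenR B (invL∨₁ d₂ ↭-refl))) (invL∨₂ d₂ ↭-refl)
  cut t (A ⊃' B) d₁ d₂ =
    cut t A (invL⊃₁ d₂ ↭-refl) (cut t B (invR⊃ d₁ ↭-refl) (permL swap₁ (weakenL A (invL⊃₂ d₂ ↭-refl))))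

  cut-prime : T (hasE X) → ∀ A → Prime A → Der X Γ Δf → Δf ↭ A ∷ Δ → Der X (A ∷ Γ) Δ → Der X Γ Δ
  cut-prime t A pa (ax p e f) g d₂ with compare-heads (relate f g)
  ... | inj₁ (≡-refl , _) = contract-var d₂ ↭-refl (∈-resp-↭ (↭-sym e) (here ≡-refl))
  ... | inj₂ (_ , _ , e₂) = ax p e e₂
  cut-prime t A pa (L⊥ e) g d₂ = L⊥ e
  cut-prime t A pa (L∧ e d) g d₂ =
    L∧ e (cut-prime t A pa d g (permL (↭-sym rotate₃) (invL∧ d₂ (keep-head A e))))
  cut-prime t A pa (R∧ {A = C} {D} e d₁ d₁') g d₂ with compare-heads (relate e g)
  ... | inj₁ (q , _) = ⊥-elim (prime≢compound pa ∧-compound (sym q))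
  ... | inj₂ (_ , e₁ , e₂) =
    R∧ e₂ (cut-prime t A pa d₁ (keep-head C e₁) (invR∧₁ d₂ e₂)) (cut-prime t A pa d₁' (keep-head D e₁) (invR∧₂ d₂ e₂))
  cut-prime t A pa (L∨ e d₁ d₁') g d₂ =
    L∨ e (cut-prime t A pa d₁ g (permL swap₁ (invL∨₁ d₂ (keep-head A e))))
         (cut-prime t A pa d₁' g (permL swap₁ (invL∨₂ d₂ (keep-head A e))))
  cut-prime t A pa (R∨ {A = C} {D} e d) g d₂ with compare-heads (relate e g)
  ... | inj₁ (q , _) = ⊥-elim (prime≢compound pa ∨-compound (sym q))
  ... | inj₂ (_ , e₁ , e₂) = R∨ e₂ (cut-prime t A pa d (↭-trans (prep C (prep D e₁)) (↭-sym rotate₃)) (invR∨ d₂ e₂))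
  cut-prime t A pa (L⊃ {A = C} e d₁ d₁') g d₂ =
    L⊃ e (cut-prime t A pa d₁ (keep-head C g) (invL⊃₁ d₂ (keep-head A e)))
         (cut-prime t A pa d₁' g (permL swap₁ (invL⊃₂ d₂ (keep-head A e))))
  cut-prime t A pa (R⊃ {B = D} e d) g d₂ with compare-heads (relate e g)
  ... | inj₁ (q , _) = ⊥-elim (prime≢compound pa ⊃-compound (sym q))
  ... | inj₂ (_ , e₁ , e₂) = R⊃ e₂ (cut-prime t A pa d (keep-head D e₁) (permL swap₁ (invR⊃ d₂ e₂)))
  cut-prime t A pa (LR-E t' e f d₁ d₁') g d₂ with compare-heads (relate f g)
  ... | inj₁ (≡-refl , _) = cut-boxed t _ (via-E (∈-resp-↭ (↭-sym e) (here ≡-refl)) d₁ d₁') d₂ ↭-refl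
  ... | inj₂ (_ , _ , e₂) = LR-E t' e e₂ d₁ d₁'
  cut-prime t A pa (R-N t' f d) g d₂ with compare-heads (relate f g)
  ... | inj₁ (≡-refl , _) = cut-boxed t _ (via-N t' d) d₂ ↭-refl
  ... | inj₂ (_ , _ , e₂) = R-N t' e₂ d
  cut-prime t A pa (LR-M t' e f d) g d₂ = ⊥-elim (E-family.no-M (E-family-of t) t')
  cut-prime t A pa (LR-R Π t' e f d) g d₂ = ⊥-elim (E-family.no-R (E-family-of t) t')
  cut-prime t A pa (LR-K Π t' e f d) g d₂ = ⊥-elim (E-family.no-K (E-family-of t) t')
  cut-prime t A pa (L-D⊥ t' e d) g d₂ = L-D⊥ t' e d
  cut-prime t A pa (L-D◇E Π t' l e d₁ d₁') g d₂ = L-D◇E Π t' l e d₁ d₁'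
  cut-prime t A pa (L-D◇M Π t' l e d) g d₂ = L-D◇M Π t' l e d
  cut-prime t A pa (L-D* Π t' e d) g d₂ = L-D* Π t' e d

  -- L-D◇E with principal formulas □B, □F, where □B is being cut away.
  cut-boxed-D◇ : ∀ {F} → T (hasE X) → T (hasD◇E X) → ∀ B → BoxEvidence X B Γ → □ F ∈ Γ →
    Der X (B ∷ F ∷ []) [] → Der X [] (B ∷ F ∷ []) → Der X Γ Δ
  cut-boxed-D◇ {F = F} t td B (via-E {C} m c₁ c₂) mF d₁ d₂ with ∈⇒↭ m
  ... | _ , eC with ∈-resp-↭ eC mF
  ... | here ≡-refl = L-D◇E [ C ] td (s≤s z≤n) eC (cut t B c₁ d₁) (cut t B d₂ c₂)
  ... | there mF' with ∈⇒↭ mF'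
  ... | _ , eF = L-D◇E (C ∷ F ∷ []) td (s≤s (s≤s z≤n)) (↭-trans eC (prep _ eF))
        (cut t B (permL swap₁ (weakenL F c₁)) (permL swap₁ (weakenL C d₁)))
        (cut t B (permR swap₁ (weakenR C d₂)) (permR swap₁ (weakenR F c₂)))
  cut-boxed-D◇ {F = F} t td B (via-N tn c) mF d₁ d₂ =
    L-D⊥ (N-D◇E⇒D⊥ tn td) (proj₂ (∈⇒↭ mF)) (cut t B (weakenL F c) d₁)

  cut-boxed : T (hasE X) → ∀ B → BoxEvidence X B Γ → Der X Γf Δ → Γf ↭ □ B ∷ Γ → Der X Γ Δ
  cut-boxed t B ev (ax p e f) g with ∈-resp-↭ g (∈-resp-↭ (↭-sym e) (here ≡-refl))
  ... | here ()
  ... | there m = ax p (proj₂ (∈⇒↭ m)) f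
  cut-boxed t B ev (L⊥ e) g with ∈-resp-↭ g (∈-resp-↭ (↭-sym e) (here ≡-refl))
  ... | here ()
  ... | there m = L⊥ (proj₂ (∈⇒↭ m))
  cut-boxed t B ev (L∧ {A = C} {D} e d) g with compare-heads (relate e g)
  ... | inj₁ (() , _)
  ... | inj₂ (_ , e₁ , e₂) =
    L∧ e₂ (cut-boxed t B (evidence-extend (evidence-extend (evidence-remove ev e₂ ∧-compound))) d
                      (↭-trans (prep C (prep D e₁)) (↭-sym rotate₃)))
  cut-boxed t B ev (R∧ e d₁ d₂) g = R∧ e (cut-boxed t B ev d₁ g) (cut-boxed t B ev d₂ g)
  cut-boxed t B ev (L∨ {A = C} {D} e d₁ d₂) g with compare-heads (relate e g)
  ... | inj₁ (() , _)
  ... | inj₂ (_ , e₁ , e₂) =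
    L∨ e₂ (cut-boxed t B (evidence-extend (evidence-remove ev e₂ ∨-compound)) d₁ (keep-head C e₁))
          (cut-boxed t B (evidence-extend (evidence-remove ev e₂ ∨-compound)) d₂ (keep-head D e₁))
  cut-boxed t B ev (R∨ e d) g = R∨ e (cut-boxed t B ev d g)
  cut-boxed t B ev (L⊃ {B = D} e d₁ d₂) g with compare-heads (relate e g)
  ... | inj₁ (() , _)
  ... | inj₂ (_ , e₁ , e₂) =
    L⊃ e₂ (cut-boxed t B (evidence-remove ev e₂ ⊃-compound) d₁ e₁)
          (cut-boxed t B (evidence-extend (evidence-remove ev e₂ ⊃-compound)) d₂ (keep-head D e₁))
  cut-boxed t B ev (R⊃ {A = C} e d) g = R⊃ e (cut-boxed t B (evidence-extend ev) d (keep-head C g))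
  cut-boxed t B ev (LR-E {B = F} t' e f d₁ d₂) g with compare-heads (relate e g) | ev
  ... | inj₂ (_ , _ , e₂) | _ = LR-E t' e₂ f d₁ d₂
  ... | inj₁ (≡-refl , _) | via-E {C} m c₁ c₂ =
    LR-E t' (proj₂ (∈⇒↭ m)) f (cut t B (permR swap₁ (weakenR F c₁)) (permL swap₁ (weakenL C d₁)))
                              (cut t B (permR swap₁ (weakenR C d₂)) (permL swap₁ (weakenL F c₂)))
  ... | inj₁ (≡-refl , _) | via-N tn c = R-N tn f (cut t B (permR swap₁ (weakenR F c)) d₁)
  cut-boxed t B ev (R-N t' f d) g = R-N t' f d
  cut-boxed t B ev (L-D⊥ t' e d) g with compare-heads (relate e g) | ev
  ... | inj₂ (_ , _ , e₂) | _ = L-D⊥ t' e₂ d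
  ... | inj₁ (≡-refl , _) | via-E {C} m c₁ c₂ = L-D⊥ t' (proj₂ (∈⇒↭ m)) (cut t B c₁ (permL swap₁ (weakenL C d)))
  ... | inj₁ (≡-refl , _) | via-N tn c = weaken-empty (cut t B c d)
  cut-boxed t B ev (L-D◇E [] t' l e d₁ d₂) g = L-D◇E [] t' l ↭-refl d₁ d₂
  cut-boxed t B ev (L-D◇E (D ∷ []) t' l e d₁ d₂) g with compare-heads (relate e g) | ev
  ... | inj₂ (_ , _ , e₂) | _ = L-D◇E [ D ] t' l e₂ d₁ d₂
  ... | inj₁ (≡-refl , _) | via-E {C} m c₁ c₂ =
    L-D◇E [ C ] t' l (proj₂ (∈⇒↭ m)) (cut t B c₁ (permL swap₁ (weakenL C d₁))) (cut t B (permR swap₁ (weakenR C d₂)) c₂)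
  ... | inj₁ (≡-refl , _) | via-N tn c = weaken-empty (cut t B c d₁)
  cut-boxed t B ev (L-D◇E (D ∷ F ∷ []) t' l e d₁ d₂) g with compare-heads (relate e g)
  ... | inj₁ (≡-refl , e') = cut-boxed-D◇ t t' B ev (∈-resp-↭ e' (here ≡-refl)) d₁ d₂
  ... | inj₂ (_ , e₁ , e₂) with compare-heads e₁
  ... | inj₁ (≡-refl , _) = cut-boxed-D◇ t t' B ev (∈-resp-↭ (↭-sym e₂) (here ≡-refl)) (permL swap₁ d₁) (permR swap₁ d₂)
  ... | inj₂ (_ , _ , e₃) = L-D◇E (D ∷ F ∷ []) t' l (↭-trans e₂ (prep _ e₃)) d₁ d₂
  cut-boxed t B ev (L-D◇E (_ ∷ _ ∷ _ ∷ _) t' (s≤s (s≤s ())) e d₁ d₂) g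
  cut-boxed t B ev (LR-M t' e f d) g = ⊥-elim (E-family.no-M (E-family-of t) t')
  cut-boxed t B ev (LR-R Π t' e f d) g = ⊥-elim (E-family.no-R (E-family-of t) t')
  cut-boxed t B ev (LR-K Π t' e f d) g = ⊥-elim (E-family.no-K (E-family-of t) t')
  cut-boxed t B ev (L-D◇M Π t' l e d) g = ⊥-elim (E-family.no-D◇M (E-family-of t) t')
  cut-boxed t B ev (L-D* Π t' e d) g = ⊥-elim (E-family.no-D* (E-family-of t) t')

infix 4 _⊑_
_⊑_ : List Fm → List Fm → Set
Φ ⊑ Ψ = ∀ {p} → OccursIn p Φ → OccursIn p Ψ

⊑-trans : ∀ {Φ Ψ Θ} → Φ ⊑ Ψ → Ψ ⊑ Θ → Φ ⊑ Θ
⊑-trans f g a = g (f a)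

⊑-perm : ∀ {Φ Ψ} → Φ ↭ Ψ → Φ ⊑ Ψ
⊑-perm e = Any-resp-↭ e

⊑-[] : ∀ {Ψ} → [] ⊑ Ψ
⊑-[] ()

⊑-∷ : ∀ {Φ Ψ} → [ A ] ⊑ Ψ → Φ ⊑ Ψ → A ∷ Φ ⊑ Ψ
⊑-∷ f g (here m) = f (here m)
⊑-∷ f g (there a) = g a

⊑-++ : ∀ {Φ₁ Φ₂ Ψ} → Φ₁ ⊑ Ψ → Φ₂ ⊑ Ψ → Φ₁ ++ Φ₂ ⊑ Ψ
⊑-++ {Φ₁ = Φ₁} f g a with Any.++⁻ Φ₁ a
... | inj₁ b = f b
... | inj₂ b = g b

⊑-++ˡ : ∀ {Φ Ψ} → Φ ⊑ Φ ++ Ψ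
⊑-++ˡ = Any.++⁺ˡ

⊑-++ʳ : ∀ Φ {Ψ} → Ψ ⊑ Φ ++ Ψ
⊑-++ʳ Φ = Any.++⁺ʳ Φ

⊑-□s : ∀ {Π} → Π ⊑ □s Π
⊑-□s (here m) = here m
⊑-□s (there a) = there (⊑-□s a)

data Binary : Fm → Fm → Fm → Set where
  ∧-binary : Binary (A ∧' B) A B
  ∨-binary : Binary (A ∨' B) A B
  ⊃-binary : Binary (A ⊃' B) A B

binary-vars : Binary C A B → vars C ≡ vars A ++ vars B
binary-vars ∧-binary = ≡-refl
binary-vars ∨-binary = ≡-refl
binary-vars ⊃-binary = ≡-refl

left-part : Binary C A B → [ A ] ⊑ [ C ]
left-part bin (here m) = here (subst (_ ∈_) (sym (binary-vars bin)) (Any.++⁺ˡ m))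

right-part : Binary C A B → [ B ] ⊑ [ C ]
right-part {A = A} bin (here m) = here (subst (_ ∈_) (sym (binary-vars bin)) (Any.++⁺ʳ (vars A) m))

both-parts : Binary C A B → A ∷ B ∷ [] ⊑ [ C ]
both-parts bin = ⊑-∷ (left-part bin) (⊑-∷ (right-part bin) ⊑-[])

join-parts : ∀ {Ψ} → Binary C A B → [ A ] ⊑ Ψ → [ B ] ⊑ Ψ → [ C ] ⊑ Ψ
join-parts {A = A} bin f g (here m) with Any.++⁻ (vars A) (subst (_ ∈_) (binary-vars bin) m)
... | inj₁ m' = f (here m')
... | inj₂ m' = g (here m')

⊑-⊥ : ∀ {Ψ} → [ ⊥' ] ⊑ Ψ
⊑-⊥ (here ())

⊑-⊤ : ∀ {Ψ} → [ ⊤' ] ⊑ Ψ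
⊑-⊤ = join-parts ⊃-binary ⊑-⊥ ⊑-⊥

⊑-unfold : ∀ {Φ Ψ Θ P} → Ψ ↭ C ∷ Θ → Φ ↭ P ++ Θ → P ⊑ [ C ] → Φ ⊑ Ψ
⊑-unfold {P = P} e g parts a with Any.++⁻ P (Any-resp-↭ g a)
... | inj₁ b with parts b
...   | here m = Any-resp-↭ (↭-sym e) (here m)
⊑-unfold e g parts a | inj₂ b = Any-resp-↭ (↭-sym e) (there b)

-- Interpolants of ⟨Γ₁ ⇒ Δ₁ ∥ Γ₂ ⇒ Δ₂⟩, with the interpolant kept at the head
-- of the left succedent so that rules can act on it directly.
record Interp (X : Calc) (Γ₁ Δ₁ Γ₂ Δ₂ : List Fm) : Set where
  constructor interp
  field
    formula : Fm
    shared₁ : [ formula ] ⊑ Γ₁ ++ Δ₁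
    shared₂ : [ formula ] ⊑ Γ₂ ++ Δ₂
    left    : Der X Γ₁ (formula ∷ Δ₁)
    right   : Der X (formula ∷ Γ₂) Δ₂

Interpolable : Calc → List Fm → List Fm → Set
Interpolable X Γ Δ = ∀ Γ₁ Δ₁ Γ₂ Δ₂ → Γ₁ ++ Γ₂ ↭ Γ → Δ₁ ++ Δ₂ ↭ Δ → Interp X Γ₁ Δ₁ Γ₂ Δ₂

-- The negation of an interpolant of the swapped partition is an interpolant;
-- so every rule need only be treated with its principal formula on one side.
swap-sides : ∀ {Γ₁ Δ₁ Γ₂ Δ₂} → Interp X Γ₂ Δ₂ Γ₁ Δ₁ → Interp X Γ₁ Δ₁ Γ₂ Δ₂
swap-sides (interp I v₂ v₁ d₂ d₁) =
  interp (¬' I) (join-parts ⊃-binary v₁ ⊑-⊥) (join-parts ⊃-binary v₂ ⊑-⊥)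
         (R⊃ ↭-refl (weakenR ⊥' d₁)) (L⊃ ↭-refl d₂ (L⊥ ↭-refl))

interp-⊥ : ∀ {Γ₁ Δ₁ Γ₂ Δ₂} → Der X Γ₁ Δ₁ → Interp X Γ₁ Δ₁ Γ₂ Δ₂
interp-⊥ d = interp ⊥' ⊑-⊥ ⊑-⊥ (weakenR ⊥' d) (L⊥ ↭-refl)

interp-⊤ : ∀ {Γ₁ Δ₁ Γ₂ Δ₂} → Der X Γ₂ Δ₂ → Interp X Γ₁ Δ₁ Γ₂ Δ₂
interp-⊤ d = interp ⊤' ⊑-⊤ ⊑-⊤ (R⊃ ↭-refl (L⊥ ↭-refl)) (weakenL ⊤' d)

locate : ∀ {Γ₁ Γ₂} → Γ₁ ++ Γ₂ ↭ G → G ↭ x ∷ G' →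
  (∃ λ Γ₁' → Γ₁ ↭ x ∷ Γ₁' × Γ₁' ++ Γ₂ ↭ G') ⊎ (∃ λ Γ₂' → Γ₂ ↭ x ∷ Γ₂' × Γ₁ ++ Γ₂' ↭ G')
locate {Γ₁ = Γ₁} {Γ₂} g e with Any.++⁻ Γ₁ (∈-resp-↭ (↭-sym (↭-trans g e)) (here ≡-refl))
... | inj₁ m with ∈⇒↭ m
...   | Γ₁' , e₁ = inj₁ (Γ₁' , e₁ , drop-∷ (↭-trans (↭-sym (++⁺ʳ Γ₂ e₁)) (↭-trans g e)))
locate {Γ₁ = Γ₁} {Γ₂} g e | inj₂ m with ∈⇒↭ m
...   | Γ₂' , e₂ = inj₂ (Γ₂' , e₂ , drop-∷ (↭-trans (↭-sym (prefix-head Γ₁ e₂)) (↭-trans g e)))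

record BoxSplit (Π Γ₁ Γ₂ G' : List Fm) : Set where
  constructor box-split
  field
    Π₁ Π₂ G₁ G₂ : List Fm
    parts : Π₁ ++ Π₂ ↭ Π
    side₁ : Γ₁ ↭ □s Π₁ ++ G₁
    side₂ : Γ₂ ↭ □s Π₂ ++ G₂
    rest  : G₁ ++ G₂ ↭ G'

split-boxes : ∀ Π {Γ₁ Γ₂} → Γ₁ ++ Γ₂ ↭ □s Π ++ G' → BoxSplit Π Γ₁ Γ₂ G'
split-boxes [] {Γ₁} {Γ₂} g = box-split [] [] Γ₁ Γ₂ ↭-refl ↭-refl ↭-refl g
split-boxes (A ∷ Π) g with locate g ↭-refl
... | inj₁ (_ , e , g') with split-boxes Π g'
...   | box-split Π₁ Π₂ G₁ G₂ p e₁ e₂ r =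
        box-split (A ∷ Π₁) Π₂ G₁ G₂ (prep A p) (↭-trans e (prep _ e₁)) e₂ r
split-boxes (A ∷ Π) g | inj₂ (_ , e , g') with split-boxes Π g'
...   | box-split Π₁ Π₂ G₁ G₂ p e₁ e₂ r =
        box-split Π₁ (A ∷ Π₂) G₁ G₂ (↭-trans (shift A Π₁ Π₂) (prep A p)) e₁ (↭-trans e (prep _ e₂)) r

unfoldL : ∀ {Γ₁ Γ₁' Δ₁ P} → Γ₁ ↭ C ∷ Γ₁' → P ⊑ [ C ] → (P ++ Γ₁') ++ Δ₁ ⊑ Γ₁ ++ Δ₁
unfoldL {Γ₁' = Γ₁'} {Δ₁} {P} e parts = ⊑-unfold (++⁺ʳ Δ₁ e) (++-assoc P Γ₁' Δ₁) parts

unfoldR : ∀ {Γ₁ Δ₁ Δ₁' P} → Δ₁ ↭ C ∷ Δ₁' → P ⊑ [ C ] → Γ₁ ++ P ++ Δ₁' ⊑ Γ₁ ++ Δ₁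
unfoldR {Γ₁ = Γ₁} {P = P} f parts = ⊑-unfold (prefix-head Γ₁ f) (shifts Γ₁ P) parts

extend : ∀ {Γ₁ Δ₁ Γ₂ Δ₂ Γa Δa} → Interp X Γa Δa Γ₂ Δ₂ → Γa ++ Δa ⊑ Γ₁ ++ Δ₁ →
  (∀ {I} → Der X Γa (I ∷ Δa) → Der X Γ₁ (I ∷ Δ₁)) → Interp X Γ₁ Δ₁ Γ₂ Δ₂
extend (interp I v₁ v₂ a b) s rule = interp I (⊑-trans v₁ s) v₂ (rule a) b

disjoin : ∀ {Γ₁ Δ₁ Γ₂ Δ₂ Γa Δa Γb Δb} → Interp X Γa Δa Γ₂ Δ₂ → Interp X Γb Δb Γ₂ Δ₂ →
  Γa ++ Δa ⊑ Γ₁ ++ Δ₁ → Γb ++ Δb ⊑ Γ₁ ++ Δ₁ →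
  (∀ {I₁ I₂} → Der X Γa (I₁ ∷ Δa) → Der X Γb (I₂ ∷ Δb) → Der X Γ₁ (I₁ ∷ I₂ ∷ Δ₁)) →
  Interp X Γ₁ Δ₁ Γ₂ Δ₂
disjoin (interp I₁ v₁ w₁ a₁ b₁) (interp I₂ v₂ w₂ a₂ b₂) s₁ s₂ rule =
  interp (I₁ ∨' I₂) (join-parts ∨-binary (⊑-trans v₁ s₁) (⊑-trans v₂ s₂)) (join-parts ∨-binary w₁ w₂)
         (R∨ ↭-refl (rule a₁ a₂)) (L∨ ↭-refl b₁ b₂)

-- Partitions that put the principal formula C of a left (right) rule into
-- the first part; by swap-sides these are the only ones to consider.
LeftCase : Calc → Fm → List Fm → List Fm → Set
LeftCase X C G' Δ = ∀ {Γ₁ Δ₁ Γ₂ Δ₂ Γ₁'} → Γ₁ ↭ C ∷ Γ₁' → Γ₁' ++ Γ₂ ↭ G' → Δ₁ ++ Δ₂ ↭ Δ →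
  Interp X Γ₁ Δ₁ Γ₂ Δ₂

RightCase : Calc → Fm → List Fm → List Fm → Set
RightCase X C Γ Δ' = ∀ {Γ₁ Δ₁ Γ₂ Δ₂ Δ₁'} → Δ₁ ↭ C ∷ Δ₁' → Δ₁' ++ Δ₂ ↭ Δ' → Γ₁ ++ Γ₂ ↭ Γ →
  Interp X Γ₁ Δ₁ Γ₂ Δ₂

by-symmetryL : LeftCase X C G' Δ → G ↭ C ∷ G' → Interpolable X G Δ
by-symmetryL case e Γ₁ Δ₁ Γ₂ Δ₂ g h with locate g e
... | inj₁ (_ , e₁ , g') = case e₁ g' h
... | inj₂ (Γ₂' , e₂ , g') = swap-sides (case e₂ (↭-trans (++-comm Γ₂' Γ₁) g') (↭-trans (++-comm Δ₂ Δ₁) h))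

by-symmetryR : RightCase X C Γ Δ' → Δ ↭ C ∷ Δ' → Interpolable X Γ Δ
by-symmetryR case f Γ₁ Δ₁ Γ₂ Δ₂ g h with locate h f
... | inj₁ (_ , f₁ , h') = case f₁ h' g
... | inj₂ (Δ₂' , f₂ , h') = swap-sides (case f₂ (↭-trans (++-comm Δ₂' Δ₁) h') (↭-trans (++-comm Γ₂ Γ₁) g))

interp-L∧ : Interpolable X (A ∷ B ∷ G') Δ → LeftCase X (A ∧' B) G' Δ
interp-L∧ {A = A} {B} ih {Γ₁' = Γ₁'} e₁ g' h =
  extend (ih (A ∷ B ∷ Γ₁') _ _ _ (prep A (prep B g')) h) (unfoldL e₁ (both-parts ∧-binary)) (L∧ e₁)

interp-L∨ : Interpolable X (A ∷ G') Δ → Interpolable X (B ∷ G') Δ → LeftCase X (A ∨' B) G' Δ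
interp-L∨ {A = A} {B = B} ih₁ ih₂ {Γ₁' = Γ₁'} e₁ g' h =
  disjoin (ih₁ (A ∷ Γ₁') _ _ _ (prep A g') h) (ih₂ (B ∷ Γ₁') _ _ _ (prep B g') h)
          (unfoldL e₁ (left-part ∨-binary)) (unfoldL e₁ (right-part ∨-binary))
          (λ a₁ a₂ → L∨ e₁ (permR swap₁ (weakenR _ a₁)) (weakenR _ a₂))

interp-L⊃ : Interpolable X G' (A ∷ Δ) → Interpolable X (B ∷ G') Δ → LeftCase X (A ⊃' B) G' Δ
interp-L⊃ {A = A} {B = B} ih₁ ih₂ {Δ₁ = Δ₁} {Γ₁' = Γ₁'} e₁ g' h =
  disjoin (ih₁ Γ₁' (A ∷ Δ₁) _ _ g' (prep A h)) (ih₂ (B ∷ Γ₁') _ _ _ (prep B g') h)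
          (⊑-unfold (++⁺ʳ Δ₁ e₁) (shift A Γ₁' Δ₁) (left-part ⊃-binary)) (unfoldL e₁ (right-part ⊃-binary))
          (λ a₁ a₂ → L⊃ e₁ (permR reverse₃ (weakenR _ a₁)) (weakenR _ a₂))

interp-R∧ : Interpolable X Γ (A ∷ Δ') → Interpolable X Γ (B ∷ Δ') → RightCase X (A ∧' B) Γ Δ'
interp-R∧ {A = A} {B = B} ih₁ ih₂ {Γ₁ = Γ₁} {Δ₁' = Δ₁'} f₁ h' g =
  disjoin (ih₁ Γ₁ (A ∷ Δ₁') _ _ g (prep A h')) (ih₂ Γ₁ (B ∷ Δ₁') _ _ g (prep B h'))
          (unfoldR f₁ (left-part ∧-binary)) (unfoldR f₁ (right-part ∧-binary))
          (λ a₁ a₂ → R∧ (↭-trans (prep _ (prep _ f₁)) (↭-sym rotate₃))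
                        (permR reverse₃ (weakenR _ a₁)) (permR (↭-sym rotate₃) (weakenR _ a₂)))

interp-R∨ : Interpolable X Γ (A ∷ B ∷ Δ') → RightCase X (A ∨' B) Γ Δ'
interp-R∨ {A = A} {B = B} ih {Γ₁ = Γ₁} {Δ₁' = Δ₁'} f₁ h' g =
  extend (ih Γ₁ (A ∷ B ∷ Δ₁') _ _ g (prep A (prep B h'))) (unfoldR f₁ (both-parts ∨-binary))
         (λ a → R∨ (keep-head _ f₁) (permR rotate₃ a))

interp-R⊃ : Interpolable X (A ∷ Γ) (B ∷ Δ') → RightCase X (A ⊃' B) Γ Δ'
interp-R⊃ {A = A} {B = B} ih {Γ₁ = Γ₁} {Δ₁' = Δ₁'} f₁ h' g =
  extend (ih (A ∷ Γ₁) (B ∷ Δ₁') _ _ (prep A g) (prep B h'))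
         (⊑-unfold (prefix-head Γ₁ f₁) (prep A (shift B Γ₁ Δ₁')) (both-parts ⊃-binary))
         (λ a → R⊃ (keep-head _ f₁) (permR swap₁ a))

Crossing : Calc → Fm → Fm → Set
Crossing X C D = ∀ {Γ₁ Δ₁ Γ₂ Δ₂ Γ₁' Δ₂'} → Γ₁ ↭ C ∷ Γ₁' → Δ₂ ↭ D ∷ Δ₂' → Interp X Γ₁ Δ₁ Γ₂ Δ₂

by-symmetry₂ : ∀ {C D H H'} → (∀ {Γ Δ Γ' Δ'} → Γ ↭ C ∷ Γ' → Δ ↭ D ∷ Δ' → Der X Γ Δ) →
  Crossing X C D → G ↭ C ∷ G' → H ↭ D ∷ H' → Interpolable X G H
by-symmetry₂ rule crossing e f Γ₁ Δ₁ Γ₂ Δ₂ g h with locate g e | locate h f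
... | inj₁ (_ , e₁ , _) | inj₁ (_ , f₁ , _) = interp-⊥ (rule e₁ f₁)
... | inj₂ (_ , e₂ , _) | inj₂ (_ , f₂ , _) = interp-⊤ (rule e₂ f₂)
... | inj₁ (_ , e₁ , _) | inj₂ (_ , f₂ , _) = crossing e₁ f₂
... | inj₂ (_ , e₂ , _) | inj₁ (_ , f₁ , _) = swap-sides (crossing e₂ f₁)

⊑-member : Γ ↭ A ∷ Γ' → [ A ] ⊑ Γ
⊑-member e (here m) = ⊑-perm (↭-sym e) (here m)

interp-ax : ∀ p → Crossing X (var p) (var p)
interp-ax p {Γ₂ = Γ₂} e₁ f₂ =
  interp (var p) (⊑-trans (⊑-member e₁) ⊑-++ˡ) (⊑-trans (⊑-member f₂) (⊑-++ʳ Γ₂))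
         (ax p e₁ ↭-refl) (ax p ↭-refl f₂)

⊑-boxed : ∀ {Π} → Γ ↭ □s Π ++ Γ' → Π ⊑ Γ
⊑-boxed e a = ⊑-perm (↭-sym e) (⊑-++ˡ (⊑-□s a))

⊑-□ : ∀ {Ψ} → [ C ] ⊑ Ψ → [ □ C ] ⊑ Ψ
⊑-□ f (here m) = f (here m)

-- LR-E split across the partition: from an interpolant C of A ⇒ B,
-- □C interpolates, the converse premisses C ⇒ A and B ⇒ C coming by cut.
interp-LR-E : T (hasE X) → Interpolable X [ A ] [ B ] → Der X [ B ] [ A ] → Crossing X (□ A) (□ B)
interp-LR-E {A = A} {B} t ih dBA {Γ₂ = Γ₂} e₁ f₂ with ih [ A ] [] [] [ B ] ↭-refl ↭-refl
... | interp C v₁ v₂ dAC dCB =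
  interp (□ C) (⊑-□ (⊑-trans v₁ (⊑-trans (⊑-boxed e₁) ⊑-++ˡ)))
               (⊑-□ (⊑-trans v₂ (⊑-trans (⊑-boxed f₂) (⊑-++ʳ Γ₂))))
         (LR-E t e₁ ↭-refl dAC dCA) (LR-E t ↭-refl f₂ dCB dBC)
  where
  dCA : Der _ [ C ] [ A ]
  dCA = cut t B (permR swap₁ (weakenR A dCB)) (permL swap₁ (weakenL C dBA))
  dBC : Der _ [ B ] [ C ]
  dBC = cut t A (permR swap₁ (weakenR C dBA)) (permL swap₁ (weakenL B dAC))

-- Calculus facts used to re-read deontic rules as modal ones.
D◇E⇒E : T (hasD◇E X) → T (hasE X)
D◇E⇒E {G3ED◇} _ = _
D◇E⇒E {G3ED} _ = _
D◇E⇒E {G3END} _ = _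

D◇M⇒M : T (hasD◇M X) → T (hasM X)
D◇M⇒M {G3MD} _ = _
D◇M⇒M {G3MND} _ = _

D*⇒R⊎K : T (hasD* X) → T (hasR X) ⊎ T (hasK X)
D*⇒R⊎K {G3RD} _ = inj₁ _
D*⇒R⊎K {G3KD} _ = inj₂ _

data BoxRule (X : Calc) : List Fm → Set where
  by-M : T (hasM X) → BoxRule X [ A ]
  by-R : ∀ {Π} → T (hasR X) → BoxRule X (A ∷ Π)
  by-K : ∀ {Π} → T (hasK X) → BoxRule X Π
  by-N : T (hasN X) → BoxRule X []

box-rule : ∀ {Π} → BoxRule X Π → Γ ↭ □s Π ++ Γ' → Δ ↭ □ B ∷ Δ' → Der X Π [ B ] → Der X Γ Δ
box-rule (by-M t) e f d = LR-M t e f d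
box-rule (by-R t) e f d = LR-R _ t e f d
box-rule (by-K t) e f d = LR-K _ t e f d
box-rule (by-N t) e f d = R-N t f d

box-rule-perm : ∀ {Π Π'} → BoxRule X Π → Π ↭ Π' → BoxRule X Π'
box-rule-perm (by-M t) p with ↭-singleton-inv (↭-sym p)
... | ≡-refl = by-M t
box-rule-perm {Π' = []} (by-R t) p with ↭-empty-inv p
... | ()
box-rule-perm {Π' = _ ∷ _} (by-R t) p = by-R t
box-rule-perm (by-K t) p = by-K t
box-rule-perm (by-N t) p with ↭-empty-inv (↭-sym p)
... | ≡-refl = by-N t

-- When Π splits into a nonempty Π₁ and Π₂, the rule applies to Π₁ and,
-- with Π₁ replaced by a single formula C, to C, Π₂.
box-rule-first : ∀ {Π Π₁ Π₂} → BoxRule X Π → (A ∷ Π₁) ++ Π₂ ↭ Π → BoxRule X (A ∷ Π₁)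
box-rule-first {Π₁ = []} (by-M t) p = by-M t
box-rule-first {Π₁ = _ ∷ _} (by-M t) p with ↭-length p
... | ()
box-rule-first (by-R t) p = by-R t
box-rule-first (by-K t) p = by-K t
box-rule-first (by-N t) p with ↭-length p
... | ()

box-rule-rest : ∀ {Π Π₁ Π₂} → BoxRule X Π → (A ∷ Π₁) ++ Π₂ ↭ Π → BoxRule X (C ∷ Π₂)
box-rule-rest {Π₁ = []} {Π₂ = []} (by-M t) p = by-M t
box-rule-rest {Π₁ = []} {Π₂ = _ ∷ _} (by-M t) p with ↭-length p
... | ()
box-rule-rest {Π₁ = _ ∷ _} (by-M t) p with ↭-length p
... | ()
box-rule-rest (by-R t) p = by-R t
box-rule-rest (by-K t) p = by-K t
box-rule-rest (by-N t) p with ↭-length p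
... | ()

-- If none of □Π
-- lies in the first part, the second part is derivable alone; otherwise an
-- interpolant C of ⟨Π₁ ⇒ ∥ Π₂ ⇒ B⟩ yields the interpolant □C.
interp-box-rule₂ : ∀ {Π Γ₁ Δ₁ Γ₂ Δ₂ Δ₂'} → BoxRule X Π → Interpolable X Π [ B ] → Der X Π [ B ] →
  BoxSplit Π Γ₁ Γ₂ G' → Δ₂ ↭ □ B ∷ Δ₂' → Interp X Γ₁ Δ₁ Γ₂ Δ₂
interp-box-rule₂ br ih d (box-split [] Π₂ _ _ p e₁ e₂ r) f₂ =
  interp-⊤ (box-rule (box-rule-perm br (↭-sym p)) e₂ f₂ (permL (↭-sym p) d))
interp-box-rule₂ {B = B} {Γ₂ = Γ₂} br ih d (box-split (A ∷ Π₁) Π₂ _ _ p e₁ e₂ r) f₂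
  with ih (A ∷ Π₁) [] Π₂ [ B ] p ↭-refl
... | interp C v₁ v₂ a b =
  interp (□ C) (⊑-□ (⊑-trans v₁ (⊑-++ (⊑-trans (⊑-boxed e₁) ⊑-++ˡ) ⊑-[])))
               (⊑-□ (⊑-trans v₂ (⊑-++ (⊑-trans (⊑-boxed e₂) ⊑-++ˡ)
                                       (⊑-trans (⊑-boxed {Π = [ B ]} f₂) (⊑-++ʳ Γ₂)))))
         (box-rule (box-rule-first br p) e₁ ↭-refl a) (box-rule (box-rule-rest br p) (prep (□ C) e₂) f₂ b)

by-box-rule : ∀ {Π} → BoxRule X Π → Interpolable X Π [ B ] → Der X Π [ B ] →
  Γ ↭ □s Π ++ Γ' → Δ ↭ □ B ∷ Δ' → Interpolable X Γ Δ
by-box-rule {Π = Π} br ih d e f Γ₁ Δ₁ Γ₂ Δ₂ g h with locate h f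
... | inj₂ (_ , f₂ , _) = interp-box-rule₂ br ih d (split-boxes Π (↭-trans g e)) f₂
... | inj₁ (_ , f₁ , _) =
  swap-sides (interp-box-rule₂ br ih d (split-boxes Π (↭-trans (↭-trans (++-comm Γ₂ Γ₁) g) e)) f₁)

data DeonticRule (X : Calc) : List Fm → Set where
  by-D⊥  : T (hasD⊥ X) → DeonticRule X [ A ]
  by-D◇M : ∀ {Π} → T (hasD◇M X) → length Π ≤ 2 → DeonticRule X Π
  by-D*  : ∀ {Π} → T (hasD* X) → DeonticRule X Π

deontic-rule : ∀ {Π} → DeonticRule X Π → Γ ↭ □s Π ++ Γ' → Der X Π [] → Der X Γ Δ
deontic-rule (by-D⊥ t) e d = L-D⊥ t e d
deontic-rule (by-D◇M t l) e d = L-D◇M _ t l e d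
deontic-rule (by-D* t) e d = L-D* _ t e d

length-resp-↭ : ∀ {Π Π' : List Fm} {n} → Π ↭ Π' → length Π ≤ n → length Π' ≤ n
length-resp-↭ {n = n} p l = subst (_≤ n) (↭-length p) l

deontic-rule-perm : ∀ {Π Π'} → DeonticRule X Π → Π ↭ Π' → DeonticRule X Π'
deontic-rule-perm (by-D⊥ t) p with ↭-singleton-inv (↭-sym p)
... | ≡-refl = by-D⊥ t
deontic-rule-perm (by-D◇M t l) p = by-D◇M t (length-resp-↭ p l)
deontic-rule-perm (by-D* t) p = by-D* t

two-singletons : ∀ {A₁ A₂ : Fm} {Π₁ Π₂ Π} → (A₁ ∷ Π₁) ++ (A₂ ∷ Π₂) ↭ Π → length Π ≤ 2 → Π₁ ≡ [] × Π₂ ≡ []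
two-singletons {A₁ = A₁} {A₂} p l = by-length {A₁ = A₁} {A₂} (length-resp-↭ (↭-sym p) l)
  where
  by-length : ∀ {A₁ A₂ : Fm} {Π₁ Π₂} → length ((A₁ ∷ Π₁) ++ (A₂ ∷ Π₂)) ≤ 2 → Π₁ ≡ [] × Π₂ ≡ []
  by-length {Π₁ = []} {Π₂ = []} _ = ≡-refl , ≡-refl
  by-length {Π₁ = []} {Π₂ = _ ∷ _} (s≤s (s≤s ()))
  by-length {Π₁ = _ ∷ []} (s≤s (s≤s ()))
  by-length {Π₁ = _ ∷ _ ∷ _} (s≤s (s≤s ()))

not-singleton : ∀ {A₁ A₂ : Fm} {Π₁ Π₂} → ¬ ((A₁ ∷ Π₁) ++ (A₂ ∷ Π₂) ↭ [ A ])
not-singleton {Π₁ = []} p with ↭-length p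
... | ()
not-singleton {Π₁ = _ ∷ _} p with ↭-length p
... | ()

-- When Π splits into two nonempty parts, a box rule applies to the first
-- and, with it replaced by one formula C, the deontic rule to C, Π₂.
deontic-first : ∀ {A₁ A₂ : Fm} {Π Π₁ Π₂} → DeonticRule X Π → (A₁ ∷ Π₁) ++ (A₂ ∷ Π₂) ↭ Π → BoxRule X (A₁ ∷ Π₁)
deontic-first (by-D⊥ t) p = ⊥-elim (not-singleton p)
deontic-first (by-D◇M t l) p with two-singletons p l
... | ≡-refl , _ = by-M (D◇M⇒M t)
deontic-first (by-D* t) p with D*⇒R⊎K t
... | inj₁ r = by-R r
... | inj₂ k = by-K k

deontic-rest : ∀ {A₁ A₂ : Fm} {Π Π₁ Π₂} → DeonticRule X Π → (A₁ ∷ Π₁) ++ (A₂ ∷ Π₂) ↭ Π → DeonticRule X (C ∷ A₂ ∷ Π₂)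
deontic-rest (by-D⊥ t) p = ⊥-elim (not-singleton p)
deontic-rest (by-D◇M t l) p with two-singletons p l
... | ≡-refl , ≡-refl = by-D◇M t (s≤s (s≤s z≤n))
deontic-rest (by-D* t) p = by-D* t

-- A deontic rule: if □Π lies wholly in one part, that part is derivable
-- alone; otherwise an interpolant C of ⟨Π₁ ⇒ ∥ Π₂ ⇒⟩ yields □C.
interp-deontic : ∀ {Π Γ₁ Δ₁ Γ₂ Δ₂} → DeonticRule X Π → Interpolable X Π [] → Der X Π [] →
  BoxSplit Π Γ₁ Γ₂ G' → Interp X Γ₁ Δ₁ Γ₂ Δ₂
interp-deontic dr ih d (box-split [] Π₂ _ _ p e₁ e₂ r) =
  interp-⊤ (deontic-rule (deontic-rule-perm dr (↭-sym p)) e₂ (permL (↭-sym p) d))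
interp-deontic dr ih d (box-split (A₁ ∷ Π₁) [] _ _ p e₁ e₂ r) =
  interp-⊥ (deontic-rule (deontic-rule-perm dr q) e₁ (permL q d))
  where
  q = ↭-trans (↭-sym p) (++-identityʳ (A₁ ∷ Π₁))
interp-deontic dr ih d (box-split (A₁ ∷ Π₁) (A₂ ∷ Π₂) _ _ p e₁ e₂ r)
  with ih (A₁ ∷ Π₁) [] (A₂ ∷ Π₂) [] p ↭-refl
... | interp C v₁ v₂ a b =
  interp (□ C) (⊑-□ (⊑-trans v₁ (⊑-++ (⊑-trans (⊑-boxed e₁) ⊑-++ˡ) ⊑-[])))
               (⊑-□ (⊑-trans v₂ (⊑-++ (⊑-trans (⊑-boxed e₂) ⊑-++ˡ) ⊑-[])))
         (box-rule (deontic-first dr p) e₁ ↭-refl a) (deontic-rule (deontic-rest dr p) (prep (□ C) e₂) b)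

-- L-D◇E: if □Π lies wholly in one part, that part is derivable alone.
-- Otherwise Π = A₁, A₂ is split, and an interpolant C of ⟨A₁ ⇒ ∥ A₂ ⇒⟩
-- yields □C: the further premisses C ⇒ A₁ (for LR-E) and ⇒ C, A₂ (for
-- L-D◇E) come by cut with the premiss ⇒ A₁, A₂.
interp-D◇E : ∀ {Π Γ₁ Δ₁ Γ₂ Δ₂} → T (hasD◇E X) → length Π ≤ 2 → Interpolable X Π [] →
  Der X Π [] → Der X [] Π → BoxSplit Π Γ₁ Γ₂ G' → Interp X Γ₁ Δ₁ Γ₂ Δ₂
interp-D◇E t l ih d₁ d₂ (box-split [] Π₂ _ _ p e₁ e₂ r) =
  interp-⊤ (L-D◇E Π₂ t (length-resp-↭ (↭-sym p) l) e₂ (permL (↭-sym p) d₁) (permR (↭-sym p) d₂))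
interp-D◇E t l ih d₁ d₂ (box-split (A₁ ∷ Π₁) [] _ _ p e₁ e₂ r) =
  interp-⊥ (L-D◇E (A₁ ∷ Π₁) t (length-resp-↭ q l) e₁ (permL q d₁) (permR q d₂))
  where
  q = ↭-trans (↭-sym p) (++-identityʳ (A₁ ∷ Π₁))
interp-D◇E t l ih d₁ d₂ (box-split (A₁ ∷ Π₁) (A₂ ∷ Π₂) _ _ p e₁ e₂ r) with two-singletons p l
... | ≡-refl , ≡-refl with ih [ A₁ ] [] [ A₂ ] [] p ↭-refl
...   | interp C v₁ v₂ dA₁C dCA₂ =
  interp (□ C) (⊑-□ (⊑-trans v₁ (⊑-++ (⊑-trans (⊑-boxed e₁) ⊑-++ˡ) ⊑-[])))
               (⊑-□ (⊑-trans v₂ (⊑-++ (⊑-trans (⊑-boxed e₂) ⊑-++ˡ) ⊑-[])))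
         (LR-E tE e₁ ↭-refl dA₁C dCA₁) (L-D◇E (C ∷ A₂ ∷ []) t (s≤s (s≤s z≤n)) (prep (□ C) e₂) dCA₂ d⇒CA₂)
  where
  tE = D◇E⇒E t
  d⇒A₁A₂ : Der _ [] (A₁ ∷ A₂ ∷ [])
  d⇒A₁A₂ = permR (↭-sym p) d₂
  dCA₁ : Der _ [ C ] [ A₁ ]
  dCA₁ = cut tE A₂ (weakenL C (permR swap₁ d⇒A₁A₂)) (weakenR A₁ (permL swap₁ dCA₂))
  d⇒CA₂ : Der _ [] (C ∷ A₂ ∷ [])
  d⇒CA₂ = cut tE A₁ (permR swap₁ (weakenR C d⇒A₁A₂)) (permR swap₁ (weakenR A₂ dA₁C))

interpolate : Der X Γ Δ → Interpolable X Γ Δ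
interpolate (ax p e f) = by-symmetry₂ (ax p) (interp-ax p) e f
interpolate (L⊥ e) = by-symmetryL (λ e₁ _ _ → interp-⊥ (L⊥ e₁)) e
interpolate (L∧ e d) = by-symmetryL (interp-L∧ (interpolate d)) e
interpolate (L∨ e d₁ d₂) = by-symmetryL (interp-L∨ (interpolate d₁) (interpolate d₂)) e
interpolate (L⊃ e d₁ d₂) = by-symmetryL (interp-L⊃ (interpolate d₁) (interpolate d₂)) e
interpolate (R∧ e d₁ d₂) = by-symmetryR (interp-R∧ (interpolate d₁) (interpolate d₂)) e
interpolate (R∨ e d) = by-symmetryR (interp-R∨ (interpolate d)) e
interpolate (R⊃ e d) = by-symmetryR (interp-R⊃ (interpolate d)) e
interpolate (LR-E t e f d₁ d₂) =
  by-symmetry₂ (λ e' f' → LR-E t e' f' d₁ d₂) (interp-LR-E t (interpolate d₁) d₂) e f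
interpolate (LR-M t e f d) = by-box-rule (by-M t) (interpolate d) d e f
interpolate (LR-R Π t e f d) = by-box-rule (by-R t) (interpolate d) d e f
interpolate (LR-K Π t e f d) = by-box-rule (by-K t) (interpolate d) d e f
interpolate (R-N t f d) = by-box-rule (by-N t) (interpolate d) d ↭-refl f
interpolate (L-D⊥ t e d) _ _ _ _ g h =
  interp-deontic (by-D⊥ t) (interpolate d) d (split-boxes _ (↭-trans g e))
interpolate (L-D◇M Π t l e d) _ _ _ _ g h =
  interp-deontic (by-D◇M t l) (interpolate d) d (split-boxes Π (↭-trans g e))
interpolate (L-D* Π t e d) _ _ _ _ g h =
  interp-deontic (by-D* t) (interpolate d) d (split-boxes Π (↭-trans g e))
interpolate (L-D◇E Π t l e d₁ d₂) _ _ _ _ g h =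
  interp-D◇E t l (interpolate d₁) d₁ d₂ (split-boxes Π (↭-trans g e))

lemma4 : (X : Calc) (Γ Δ : List Fm) → Der X Γ Δ →
    (Γ₁ Δ₁ Γ₂ Δ₂ : List Fm) → (Γ₁ ++ Γ₂) ↭ Γ → (Δ₁ ++ Δ₂) ↭ Δ →
    Σ Fm (Interpolant X Γ₁ Δ₁ Γ₂ Δ₂)
lemma4 X Γ Δ d Γ₁ Δ₁ Γ₂ Δ₂ g h with interpolate d Γ₁ Δ₁ Γ₂ Δ₂ g h
... | interp I v₁ v₂ a b = I , (λ p m → v₁ (here m) , v₂ (here m)) , permR (++-comm [ I ] Δ₁) a , b
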